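{- (a) If $e$ is an edge of $G$ such that $(G,h)$ is not AT and $(G-e,h)$ is not AT, then stretching $e$ gives a pair $(G',h')$ that is not AT. (b) Let $G$ be a graph with an induced path $u_1v_1v_2u_2$ such that $d_G(v_1)=d_G(v_2)=2$, and let $h:V(G)\to\mathbb{N}$ with $h(v_1)=h(v_2)=0$. If $(G,h)$ is AT and $(G-v_1-v_2,h)$ is not AT, then $\big((G-v_1-v_2)+u_1u_2,\ h|_{V(G)\setminus\{v_1,v_2\}}\big)$ is AT.
   Context: For an orientation $D$ of a graph, a spanning Eulerian subgraph is a spanning subgraph in which every vertex has indegree equal to outdegree; $EE(D)$ (resp. $EO(D)$) is the number of spanning Eulerian subgraphs with an even (resp. odd) number of edges. $D$ is AT if $EE(D)\ne EO(D)$. For $h:V(G)\to\mathbb{N}$, $(G,h)$ is AT if $G$ has an AT orientation $D$ with $d_D^+(v)\le d_G(v)-h(v)-1$ for every vertex $v$; for a subgraph $H$, $(H,h)$ means $(H,h|_{V(H)})$ with degrees taken in $H$. Stretching an edge $e=u_1u_2$ of $(G,h)$ produces $(G',h')$, where $G'$ replaces $e$ by a path $u_1w_1w_2u_2$ with two new vertices, $h'(w_1)=h'(w_2)=0$, and $h'=h$ elsewhere. -}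

module Defs where

open import Data.Bool using (Bool; true; false; T)
open import Data.Nat using (ℕ; zero; suc; _+_; _≤_; _%_)
import Data.Nat as ℕ
open import Data.Fin using (Fin; zero; suc)
import Data.Fin.Properties as FinP
open import Data.List using (List; []; _∷_; _++_; [_]; length; filter; map; removeAt)
open import Data.List.Relation.Unary.All using (All)
open import Data.List.Relation.Unary.AllPairs using (AllPairs)
open import Data.List.Relation.Binary.Pointwise using (Pointwise)
open import Data.List.Membership.Propositional using (_∈_)
open import Data.Product using (_×_; _,_; proj₁; proj₂; Σ; ∃; swap)
open import Data.Sum using (_⊎_)
open import Relation.Nullary using (¬_; Dec; yes; no)
open import Relation.Nullary.Decidable using (_×-dec_; ¬?)
open import Relation.Binary.PropositionalEquality using (_≡_; _≢_)

-- A graph lives in an ambient vertex type Fin n; its vertex set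
-- is the set of v with V v ≡ true, and its edges are a list of vertex
-- pairs (each pair is an undirected edge, listed in an arbitrary direction).

record Graph (n : ℕ) : Set where
  constructor mkGraph
  field
    V : Fin n → Bool
    E : List (Fin n × Fin n)
open Graph public

Arc : ℕ → Set
Arc n = Fin n × Fin n

SameEdge : ∀ {n} → Arc n → Arc n → Set
SameEdge e f = f ≡ e ⊎ f ≡ swap e

Simple : ∀ {n} → Graph n → Set
Simple G =
  All (λ e → proj₁ e ≢ proj₂ e × V G (proj₁ e) ≡ true × V G (proj₂ e) ≡ true) (E G)
  × AllPairs (λ e f → ¬ SameEdge e f) (E G)

Adj : ∀ {n} → Graph n → Fin n → Fin n → Set
Adj G a b = (a , b) ∈ E G ⊎ (b , a) ∈ E G

deg : ∀ {n} → Graph n → Fin n → ℕ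
deg G v = length (filter (λ e → (proj₁ e FinP.≟ v)) (E G))
        + length (filter (λ e → (proj₂ e FinP.≟ v)) (E G))

-- Digraphs given as lists of arcs (tail , head)

outdeg : ∀ {n} → List (Arc n) → Fin n → ℕ
outdeg D v = length (filter (λ a → proj₁ a FinP.≟ v) D)

indeg : ∀ {n} → List (Arc n) → Fin n → ℕ
indeg D v = length (filter (λ a → proj₂ a FinP.≟ v) D)

IsOrientation : ∀ {n} → Graph n → List (Arc n) → Set
IsOrientation G D = Pointwise SameEdge (E G) D

-- all spanning subgraphs of a digraph (sub-lists by position)
subsets : ∀ {A : Set} → List A → List (List A)
subsets [] = [] ∷ []
subsets (x ∷ xs) = subsets xs ++ map (x ∷_) (subsets xs)

Eulerian : ∀ {n} → List (Arc n) → Set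
Eulerian {n} S = (v : Fin n) → indeg S v ≡ outdeg S v

eulerian? : ∀ {n} (S : List (Arc n)) → Dec (Eulerian S)
eulerian? S = FinP.all? (λ v → indeg S v ℕ.≟ outdeg S v)

EvenSize : ∀ {A : Set} → List A → Set
EvenSize S = length S % 2 ≡ 0

evenSize? : ∀ {A : Set} (S : List A) → Dec (EvenSize S)
evenSize? S = (length S % 2) ℕ.≟ 0

EE : ∀ {n} → List (Arc n) → ℕ
EE D = length (filter (λ S → eulerian? S ×-dec evenSize? S) (subsets D))

EO : ∀ {n} → List (Arc n) → ℕ
EO D = length (filter (λ S → eulerian? S ×-dec ¬? (evenSize? S)) (subsets D))

IsATOrientation : ∀ {n} → List (Arc n) → Set
IsATOrientation D = EE D ≢ EO D

-- (G , h) is AT: some AT orientation D with d⁺_D(v) ≤ d_G(v) - h(v) - 1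
-- for every vertex v of G (stated without truncated subtraction).
AT : ∀ {n} → Graph n → (Fin n → ℕ) → Set
AT {n} G h = ∃ λ D → IsOrientation G D × IsATOrientation D
  × ((v : Fin n) → V G v ≡ true → outdeg D v + h v + 1 ≤ deg G v)

deleteEdge : ∀ {n} (G : Graph n) → Fin (length (E G)) → Graph n
deleteEdge G i = mkGraph (V G) (removeAt (E G) i)

deleteVertex : ∀ {n} → Graph n → Fin n → Graph n
deleteVertex {n} G v = mkGraph V' (filter notInc (E G))
  where
  V' : Fin n → Bool
  V' w with w FinP.≟ v
  ... | yes _ = false
  ... | no _ = V G w
  notInc : (e : Arc n) → Dec (proj₁ e ≢ v × proj₂ e ≢ v)
  notInc e = ¬? (proj₁ e FinP.≟ v) ×-dec ¬? (proj₂ e FinP.≟ v)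

addEdge : ∀ {n} → Graph n → Fin n → Fin n → Graph n
addEdge G a b = mkGraph (V G) ((a , b) ∷ E G)

-- Stretching the edge at position i: new ambient Fin (2 + n), the new
-- vertices are w₁ = zero, w₂ = suc zero, old vertex v becomes suc (suc v).
liftV : ∀ {n} → Fin n → Fin (suc (suc n))
liftV v = suc (suc v)

liftA : ∀ {n} → Arc n → Arc (suc (suc n))
liftA (a , b) = liftV a , liftV b

stretchGraph : ∀ {n} (G : Graph n) → Fin (length (E G)) → Graph (suc (suc n))
stretchGraph {n} G i =
  mkGraph V' (map liftA (removeAt (E G) i)
              ++ (liftV u₁ , w₁) ∷ (w₁ , w₂) ∷ (w₂ , liftV u₂) ∷ [])
  where
  u₁ = proj₁ (Data.List.lookup (E G) i)
  u₂ = proj₂ (Data.List.lookup (E G) i)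
  w₁ w₂ : Fin (suc (suc n))
  w₁ = zero
  w₂ = suc zero
  V' : Fin (suc (suc n)) → Bool
  V' zero = true
  V' (suc zero) = true
  V' (suc (suc v)) = V G v

stretchH : ∀ {n} → (Fin n → ℕ) → Fin (suc (suc n)) → ℕ
stretchH h zero = 0
stretchH h (suc zero) = 0
stretchH h (suc (suc v)) = h v

module Submission where

-- Both parts rest on one local analysis (pathReduction).  Let an orientation consist of
-- arcs t₁ t₂ t₃ of a path p – x – y – q followed by arcs R avoiding x and y, and let x and
-- y have out-degree at most one.  Splitting its sub-digraphs by the path arcs they contain,
-- every part vanishes in which x or y is a sink or a source, so either
--   * the path is directed (from p to q or back): the orientation has the Eulerian counts
--     of R plus a chord between p and q, and the degrees of that digraph outside x, y; or
--   * the path is blocked (p → x and q → y): it has the Eulerian counts of R, and outside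
--     x, y its out-degrees and degrees exceed those of R by the ends of the edge pq.
-- AT-transfer turns such a comparison into an AT orientation of the other graph.  In (a)
-- the path is the stretched edge, and the two cases yield AT orientations of (G , h) and
-- of (G - e , h).  In (b) the path lies in G, and they yield AT orientations of
-- (G - v₁ - v₂ + u₁u₂ , h) and of (G - v₁ - v₂ , h).

open import Defs
open import Data.Bool using (Bool; true; false; if_then_else_)
open import Data.Nat using (ℕ; zero; suc; _+_; _≤_; _%_; z≤n; s≤s)
import Data.Nat.Properties as ℕ
open import Data.Nat.DivMod using ([m+n]%n≡m%n)
open import Data.Fin using (Fin; zero; suc)
import Data.Fin.Properties as Fin
open import Data.List using (List; []; _∷_; _++_; [_]; length; filter; map; removeAt; lookup)
open import Data.List.Properties
  using (map-++; map-∘; length-map; filter-none; filter-all; filter-accept; filter-reject)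
open import Data.List.Relation.Unary.All as All using (All; []; _∷_)
import Data.List.Relation.Unary.All.Properties as All
open import Data.List.Relation.Unary.Any using (Any; here; there)
import Data.List.Relation.Unary.Any.Properties as Any
open import Data.List.Relation.Binary.Pointwise using (Pointwise; []; _∷_; All-resp-Pointwise)
open import Data.List.Relation.Binary.Permutation.Propositional as ↭
  using (_↭_; prep; ↭-sym; ↭-reflexive)
open import Data.List.Relation.Binary.Permutation.Propositional.Properties
  using (↭-length; filter-↭; ++-comm; shift; ∈-resp-↭)
open import Data.List.Membership.Propositional using (_∈_)
open import Data.List.Membership.Propositional.Properties using (∈-∃++)
open import Data.Product using (_×_; _,_; proj₁; proj₂; Σ-syntax)
open import Data.Sum using (_⊎_; inj₁; inj₂)
open import Data.Empty using (⊥-elim)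
open import Data.Unit using (⊤; tt)
open import Relation.Nullary using (¬_; yes; no; does)
open import Relation.Nullary.Decidable using (_×-dec_; ¬?)
open import Relation.Unary using (Decidable)
open import Relation.Binary.PropositionalEquality
  using (_≡_; _≢_; refl; sym; trans; cong; cong₂; subst; subst₂; ≢-sym; module ≡-Reasoning)
open import Algebra.Properties.CommutativeSemigroup ℕ.+-commutativeSemigroup
  using (interchange; x∙yz≈y∙xz)

private
  variable
    A B : Set
    m n : ℕ

count : {P : A → Set} → Decidable P → List A → ℕ
count P? xs = length (filter P? xs)

count-++ : {P : A → Set} (P? : Decidable P) (xs ys : List A) →
           count P? (xs ++ ys) ≡ count P? xs + count P? ys
count-++ P? []       ys = refl
count-++ P? (x ∷ xs) ys with does (P? x)
... | true  = cong suc (count-++ P? xs ys)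
... | false = count-++ P? xs ys

count-map : {P : B → Set} (P? : Decidable P) (f : A → B) (xs : List A) →
            count P? (map f xs) ≡ count (λ x → P? (f x)) xs
count-map P? f []       = refl
count-map P? f (x ∷ xs) with does (P? (f x))
... | true  = cong suc (count-map P? f xs)
... | false = count-map P? f xs

count-cong : {R P Q : A → Set} (P? : Decidable P) (Q? : Decidable Q) →
             (∀ {x} → R x → P x → Q x) → (∀ {x} → R x → Q x → P x) →
             {xs : List A} → All R xs → count P? xs ≡ count Q? xs
count-cong P? Q? P⇒Q Q⇒P []                 = refl
count-cong P? Q? P⇒Q Q⇒P {x ∷ xs} (r ∷ rs) with P? x | Q? x
... | yes _  | yes _  = cong suc (count-cong P? Q? P⇒Q Q⇒P rs)
... | no _   | no _   = count-cong P? Q? P⇒Q Q⇒P rs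
... | yes px | no ¬qx = ⊥-elim (¬qx (P⇒Q r px))
... | no ¬px | yes qx = ⊥-elim (¬px (Q⇒P r qx))

count-none : {R P : A → Set} (P? : Decidable P) → (∀ {x} → R x → ¬ P x) →
             {xs : List A} → All R xs → count P? xs ≡ 0
count-none P? ¬P rs = cong length (filter-none P? (All.map ¬P rs))

count-some : {P : A → Set} (P? : Decidable P) {xs : List A} → Any P xs → count P? xs ≢ 0
count-some P? {x ∷ xs} (here px) with P? x
... | yes _  = λ ()
... | no ¬px = ⊥-elim (¬px px)
count-some P? {x ∷ xs} (there pxs) with does (P? x)
... | true  = λ ()
... | false = count-some P? pxs

count-subsets-∷ : {P : List A → Set} (P? : Decidable P) (a : A) (L : List A) →
  count P? (subsets (a ∷ L)) ≡ count P? (subsets L) + count (λ S → P? (a ∷ S)) (subsets L)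
count-subsets-∷ P? a L =
  trans (count-++ P? (subsets L) _) (cong (count P? (subsets L) +_) (count-map P? (a ∷_) (subsets L)))

count-subsets-∷∷ : {P : List A → Set} (P? : Decidable P) (a b : A) (L : List A) →
  count P? (subsets (a ∷ b ∷ L))
    ≡ (count P? (subsets L) + count (λ S → P? (b ∷ S)) (subsets L))
      + (count (λ S → P? (a ∷ S)) (subsets L) + count (λ S → P? (a ∷ b ∷ S)) (subsets L))
count-subsets-∷∷ P? a b L =
  trans (count-subsets-∷ P? a (b ∷ L))
        (cong₂ _+_ (count-subsets-∷ P? b L) (count-subsets-∷ (λ S → P? (a ∷ S)) b L))

subsets-All : {R : A → Set} {L : List A} → All R L → All (All R) (subsets L)
subsets-All []       = [] ∷ []
subsets-All (r ∷ rs) = All.++⁺ (subsets-All rs) (All.map⁺ (All.map (r ∷_) (subsets-All rs)))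

subsets-map : (f : A → B) (L : List A) → subsets (map f L) ≡ map (map f) (subsets L)
subsets-map f []      = refl
subsets-map f (a ∷ L) = begin
  subsets (map f L) ++ map (f a ∷_) (subsets (map f L))
    ≡⟨ cong (λ X → X ++ map (f a ∷_) X) (subsets-map f L) ⟩
  map (map f) (subsets L) ++ map (f a ∷_) (map (map f) (subsets L))
    ≡⟨ cong (map (map f) (subsets L) ++_) (trans (sym (map-∘ (subsets L))) (map-∘ (subsets L))) ⟩
  map (map f) (subsets L) ++ map (map f) (map (a ∷_) (subsets L))
    ≡⟨ sym (map-++ (map f) (subsets L) _) ⟩
  map (map f) (subsets (a ∷ L)) ∎
  where open ≡-Reasoning

PermInvariant : (List A → Set) → Set
PermInvariant P = ∀ {S S'} → S ↭ S' → P S → P S'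

count-subsets-↭ : {P : List A → Set} (P? : Decidable P) → PermInvariant P →
                  {xs ys : List A} → xs ↭ ys → count P? (subsets xs) ≡ count P? (subsets ys)
count-subsets-↭ P? inv ↭.refl = refl
count-subsets-↭ P? inv (prep {xs} {ys} x p) = begin
  count P? (subsets (x ∷ xs))
    ≡⟨ count-subsets-∷ P? x xs ⟩
  count P? (subsets xs) + count (λ S → P? (x ∷ S)) (subsets xs)
    ≡⟨ cong₂ _+_ (count-subsets-↭ P? inv p)
                 (count-subsets-↭ (λ S → P? (x ∷ S)) (λ σ → inv (prep x σ)) p) ⟩
  count P? (subsets ys) + count (λ S → P? (x ∷ S)) (subsets ys)
    ≡⟨ sym (count-subsets-∷ P? x ys) ⟩
  count P? (subsets (x ∷ ys)) ∎
  where open ≡-Reasoning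
count-subsets-↭ {P = P} P? inv (↭.swap {xs} {ys} x y p) = begin
  count P? (subsets (x ∷ y ∷ xs))
    ≡⟨ count-subsets-∷∷ P? x y xs ⟩
  (count P? (subsets xs) + count Py? (subsets xs))
    + (count Px? (subsets xs) + count Pxy? (subsets xs))
    ≡⟨ cong₂ _+_ (cong₂ _+_ (count-subsets-↭ P? inv p) (count-subsets-↭ Py? (λ σ → inv (prep y σ)) p))
                 (cong₂ _+_ (count-subsets-↭ Px? (λ σ → inv (prep x σ)) p) xy≡yx) ⟩
  (count P? (subsets ys) + count Py? (subsets ys))
    + (count Px? (subsets ys) + count Pyx? (subsets ys))
    ≡⟨ interchange (count P? (subsets ys)) _ _ _ ⟩
  (count P? (subsets ys) + count Px? (subsets ys))
    + (count Py? (subsets ys) + count Pyx? (subsets ys))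
    ≡⟨ sym (count-subsets-∷∷ P? y x ys) ⟩
  count P? (subsets (y ∷ x ∷ ys)) ∎
  where
  open ≡-Reasoning
  Px? : Decidable (λ S → P (x ∷ S))
  Px?  S = P? (x ∷ S)
  Py? : Decidable (λ S → P (y ∷ S))
  Py?  S = P? (y ∷ S)
  Pxy? : Decidable (λ S → P (x ∷ y ∷ S))
  Pxy? S = P? (x ∷ y ∷ S)
  Pyx? : Decidable (λ S → P (y ∷ x ∷ S))
  Pyx? S = P? (y ∷ x ∷ S)
  xy≡yx : count Pxy? (subsets xs) ≡ count Pyx? (subsets ys)
  xy≡yx = trans (count-subsets-↭ Pxy? (λ σ → inv (prep x (prep y σ))) p)
                (count-cong {R = λ _ → ⊤} Pxy? Pyx?
                   (λ _ → inv (↭.swap x y ↭.refl)) (λ _ → inv (↭.swap y x ↭.refl))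
                   (All.universal (λ _ → tt) (subsets ys)))
count-subsets-↭ P? inv (↭.trans p q) = trans (count-subsets-↭ P? inv p) (count-subsets-↭ P? inv q)

δ : Fin m → Fin m → ℕ
δ u v = if does (u Fin.≟ v) then 1 else 0

δ-self : (v : Fin m) → δ v v ≡ 1
δ-self v with v Fin.≟ v
... | yes _   = refl
... | no v≢v = ⊥-elim (v≢v refl)

δ-other : {u v : Fin m} → u ≢ v → δ u v ≡ 0
δ-other {u = u} {v} u≢v with u Fin.≟ v
... | yes u≡v = ⊥-elim (u≢v u≡v)
... | no _    = refl

δ-zero : {u v : Fin m} → δ u v ≡ 0 → u ≢ v
δ-zero {v = v} δ≡0 refl = ℕ.1+n≢0 (trans (sym (δ-self v)) δ≡0)

outdeg-∷ : (e : Arc m) (L : List (Arc m)) (v : Fin m) →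
           outdeg (e ∷ L) v ≡ δ (proj₁ e) v + outdeg L v
outdeg-∷ e L v with proj₁ e Fin.≟ v
... | yes _ = refl
... | no _  = refl

indeg-∷ : (e : Arc m) (L : List (Arc m)) (v : Fin m) →
          indeg (e ∷ L) v ≡ δ (proj₂ e) v + indeg L v
indeg-∷ e L v with proj₂ e Fin.≟ v
... | yes _ = refl
... | no _  = refl

outdeg-++ : (L L' : List (Arc m)) (v : Fin m) → outdeg (L ++ L') v ≡ outdeg L v + outdeg L' v
outdeg-++ L L' v = count-++ (λ e → proj₁ e Fin.≟ v) L L'

indeg-++ : (L L' : List (Arc m)) (v : Fin m) → indeg (L ++ L') v ≡ indeg L v + indeg L' v
indeg-++ L L' v = count-++ (λ e → proj₂ e Fin.≟ v) L L'

outdeg-↭ : {L L' : List (Arc m)} → L ↭ L' → (v : Fin m) → outdeg L v ≡ outdeg L' v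
outdeg-↭ σ v = ↭-length (filter-↭ (λ e → proj₁ e Fin.≟ v) σ)

indeg-↭ : {L L' : List (Arc m)} → L ↭ L' → (v : Fin m) → indeg L v ≡ indeg L' v
indeg-↭ σ v = ↭-length (filter-↭ (λ e → proj₂ e Fin.≟ v) σ)

-- the number of arc ends at v (a loop counts twice); deg G v is degree (E G) v
degree : List (Arc m) → Fin m → ℕ
degree L v = outdeg L v + indeg L v

ends : Arc m → Fin m → ℕ
ends e v = δ (proj₁ e) v + δ (proj₂ e) v

degree-∷ : (e : Arc m) (L : List (Arc m)) (v : Fin m) → degree (e ∷ L) v ≡ ends e v + degree L v
degree-∷ e L v = trans (cong₂ _+_ (outdeg-∷ e L v) (indeg-∷ e L v))
                       (interchange (δ (proj₁ e) v) (outdeg L v) (δ (proj₂ e) v) (indeg L v))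

degree-++ : (L L' : List (Arc m)) (v : Fin m) → degree (L ++ L') v ≡ degree L v + degree L' v
degree-++ L L' v = trans (cong₂ _+_ (outdeg-++ L L' v) (indeg-++ L L' v))
                         (interchange (outdeg L v) (outdeg L' v) (indeg L v) (indeg L' v))

degree-↭ : {L L' : List (Arc m)} → L ↭ L' → (v : Fin m) → degree L v ≡ degree L' v
degree-↭ σ v = cong₂ _+_ (outdeg-↭ σ v) (indeg-↭ σ v)

ends-SameEdge : {e f : Arc m} → SameEdge e f → (v : Fin m) → ends f v ≡ ends e v
ends-SameEdge (inj₁ refl) v = refl
ends-SameEdge {e = e} (inj₂ refl) v = ℕ.+-comm (δ (proj₂ e) v) (δ (proj₁ e) v)

degree-orientation : {E D : List (Arc m)} → Pointwise SameEdge E D → (v : Fin m) →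
                     degree D v ≡ degree E v
degree-orientation []                        v = refl
degree-orientation {E = e ∷ E} {f ∷ D} (s ∷ ps) v = begin
  degree (f ∷ D) v      ≡⟨ degree-∷ f D v ⟩
  ends f v + degree D v ≡⟨ cong₂ _+_ (ends-SameEdge s v) (degree-orientation ps v) ⟩
  ends e v + degree E v ≡⟨ sym (degree-∷ e E v) ⟩
  degree (e ∷ E) v      ∎
  where open ≡-Reasoning

Avoids : Fin m → Arc m → Set
Avoids v e = proj₁ e ≢ v × proj₂ e ≢ v

avoids-SameEdge : {v : Fin m} {e f : Arc m} → SameEdge e f → Avoids v e → Avoids v f
avoids-SameEdge (inj₁ refl) a       = a
avoids-SameEdge (inj₂ refl) (a , b) = b , a

outdeg-avoid : {v : Fin m} {L : List (Arc m)} → All (Avoids v) L → outdeg L v ≡ 0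
outdeg-avoid {v = v} = count-none (λ e → proj₁ e Fin.≟ v) proj₁

indeg-avoid : {v : Fin m} {L : List (Arc m)} → All (Avoids v) L → indeg L v ≡ 0
indeg-avoid {v = v} = count-none (λ e → proj₂ e Fin.≟ v) proj₂

degree-zero⇒avoid : {v : Fin m} (L : List (Arc m)) → degree L v ≡ 0 → All (Avoids v) L
degree-zero⇒avoid []          _   = []
degree-zero⇒avoid {v = v} (e ∷ L) deg≡0 =
  (δ-zero (ℕ.m+n≡0⇒m≡0 _ ends≡0) , δ-zero (ℕ.m+n≡0⇒n≡0 _ ends≡0))
  ∷ degree-zero⇒avoid L (ℕ.m+n≡0⇒n≡0 (ends e v) sum≡0)
  where
  sum≡0 : ends e v + degree L v ≡ 0
  sum≡0 = trans (sym (degree-∷ e L v)) deg≡0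
  ends≡0 : ends e v ≡ 0
  ends≡0 = ℕ.m+n≡0⇒m≡0 _ sum≡0

-- Eulerian sub-digraphs counted by parity; a vertex that is a sink or a source rules them out.

EulerianOfParity : Bool → List (Arc m) → Set
EulerianOfParity true  S = Eulerian S × EvenSize S
EulerianOfParity false S = Eulerian S × ¬ EvenSize S

eulerianOfParity? : (b : Bool) → Decidable (EulerianOfParity {m} b)
eulerianOfParity? true  S = eulerian? S ×-dec evenSize? S
eulerianOfParity? false S = eulerian? S ×-dec ¬? (evenSize? S)

eulerianOfParity⇒eulerian : (b : Bool) {S : List (Arc m)} → EulerianOfParity b S → Eulerian S
eulerianOfParity⇒eulerian true  = proj₁
eulerianOfParity⇒eulerian false = proj₁

-- eulerianCount true D is EE D and eulerianCount false D is EO D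
eulerianCount : Bool → List (Arc m) → ℕ
eulerianCount b D = count (eulerianOfParity? b) (subsets D)

eulerianOfParity-transfer : (b : Bool) {S : List (Arc m)} {S' : List (Arc n)} →
  (Eulerian S → Eulerian S') → length S % 2 ≡ length S' % 2 →
  EulerianOfParity b S → EulerianOfParity b S'
eulerianOfParity-transfer true  eul par (e , even) = eul e , trans (sym par) even
eulerianOfParity-transfer false eul par (e , odd)  = eul e , λ even → odd (trans par even)

eulerian-↭ : {S S' : List (Arc m)} → S ↭ S' → Eulerian S → Eulerian S'
eulerian-↭ σ e v = trans (sym (indeg-↭ σ v)) (trans (e v) (outdeg-↭ σ v))

eulerianCount-↭ : {D D' : List (Arc m)} → D ↭ D' → (b : Bool) → eulerianCount b D ≡ eulerianCount b D'
eulerianCount-↭ σ b = count-subsets-↭ (eulerianOfParity? b)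
  (λ τ → eulerianOfParity-transfer b (eulerian-↭ τ) (cong (_% 2) (↭-length τ))) σ

AT-orientation-transfer : {D : List (Arc m)} {D' : List (Arc n)} →
  ((b : Bool) → eulerianCount b D ≡ eulerianCount b D') → IsATOrientation D' → IsATOrientation D
AT-orientation-transfer same at' EE≡EO = at' (trans (sym (same true)) (trans EE≡EO (same false)))

Sink Source : Fin m → List (Arc m) → Set
Sink   v L = All (λ e → proj₁ e ≢ v) L × Any (λ e → proj₂ e ≡ v) L
Source v L = All (λ e → proj₂ e ≢ v) L × Any (λ e → proj₁ e ≡ v) L

sink-unbalanced : {v : Fin m} {L : List (Arc m)} → Sink v L → indeg L v ≢ outdeg L v
sink-unbalanced {v = v} (noneOut , someIn) in≡out =
  count-some (λ e → proj₂ e Fin.≟ v) someIn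
    (trans in≡out (count-none (λ e → proj₁ e Fin.≟ v) (λ ne → ne) noneOut))

source-unbalanced : {v : Fin m} {L : List (Arc m)} → Source v L → indeg L v ≢ outdeg L v
source-unbalanced {v = v} (noneIn , someOut) in≡out =
  count-some (λ e → proj₁ e Fin.≟ v) someOut
    (trans (sym in≡out) (count-none (λ e → proj₂ e Fin.≟ v) (λ ne → ne) noneIn))

withPrefix : Bool → List (Arc m) → List (Arc m) → ℕ
withPrefix b T R = count (λ S → eulerianOfParity? b (T ++ S)) (subsets R)

-- Arcs avoiding v cannot repair a prefix that is a sink or a source at v.
withPrefix-unbalanced : (b : Bool) {v : Fin m} {T R : List (Arc m)} →
  All (Avoids v) R → Sink v T ⊎ Source v T → withPrefix b T R ≡ 0
withPrefix-unbalanced {m = m} b {v} {T} {R} avoidR unbalancedT =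
  count-none (λ S → eulerianOfParity? b (T ++ S)) (notEulerian unbalancedT) (subsets-All avoidR)
  where
  notEulerian : Sink v T ⊎ Source v T → {S : List (Arc m)} → All (Avoids v) S →
                ¬ EulerianOfParity b (T ++ S)
  notEulerian (inj₁ (noneOut , someIn)) avoidS eul =
    sink-unbalanced (All.++⁺ noneOut (All.map proj₁ avoidS) , Any.++⁺ˡ someIn)
                    (eulerianOfParity⇒eulerian b eul v)
  notEulerian (inj₂ (noneIn , someOut)) avoidS eul =
    source-unbalanced (All.++⁺ noneIn (All.map proj₂ avoidS) , Any.++⁺ˡ someOut)
                      (eulerianOfParity⇒eulerian b eul v)

record Inner (p x y q : Fin m) : Set where
  field
    p≢x : p ≢ x
    p≢y : p ≢ y
    q≢x : q ≢ x
    q≢y : q ≢ y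
    x≢y : x ≢ y

  y≢x : y ≢ x
  y≢x = ≢-sym x≢y

  reversed : Inner q y x p
  reversed = record { p≢x = q≢y ; p≢y = q≢x ; q≢x = p≢y ; q≢y = p≢x ; x≢y = y≢x }

eulerianCount-∷∷∷ : (b : Bool) (a₁ a₂ a₃ : Arc m) (R : List (Arc m)) →
  eulerianCount b (a₁ ∷ a₂ ∷ a₃ ∷ R)
    ≡ ((withPrefix b [] R + withPrefix b [ a₃ ] R)
        + (withPrefix b [ a₂ ] R + withPrefix b (a₂ ∷ a₃ ∷ []) R))
      + ((withPrefix b [ a₁ ] R + withPrefix b (a₁ ∷ a₃ ∷ []) R)
        + (withPrefix b (a₁ ∷ a₂ ∷ []) R + withPrefix b (a₁ ∷ a₂ ∷ a₃ ∷ []) R))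
eulerianCount-∷∷∷ b a₁ a₂ a₃ R =
  trans (count-subsets-∷ (eulerianOfParity? b) a₁ (a₂ ∷ a₃ ∷ R))
        (cong₂ _+_ (count-subsets-∷∷ (eulerianOfParity? b) a₂ a₃ R)
                   (count-subsets-∷∷ (λ S → eulerianOfParity? b (a₁ ∷ S)) a₂ a₃ R))

sum-first-last : ∀ a {b c d e f g} h → b ≡ 0 → c ≡ 0 → d ≡ 0 → e ≡ 0 → f ≡ 0 → g ≡ 0 →
                 ((a + b) + (c + d)) + ((e + f) + (g + h)) ≡ a + h
sum-first-last a h refl refl refl refl refl refl =
  cong (_+ h) (trans (ℕ.+-identityʳ (a + 0)) (ℕ.+-identityʳ a))

path-indeg : (p x y q : Fin m) (S : List (Arc m)) (v : Fin m) →
  indeg ((p , x) ∷ (x , y) ∷ (y , q) ∷ S) v ≡ (δ x v + δ y v) + indeg ((p , q) ∷ S) v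
path-indeg p x y q S v = begin
  indeg ((p , x) ∷ (x , y) ∷ (y , q) ∷ S) v
    ≡⟨ indeg-∷ (p , x) _ v ⟩
  δ x v + indeg ((x , y) ∷ (y , q) ∷ S) v
    ≡⟨ cong (δ x v +_) (indeg-∷ (x , y) _ v) ⟩
  δ x v + (δ y v + indeg ((y , q) ∷ S) v)
    ≡⟨ sym (ℕ.+-assoc (δ x v) _ _) ⟩
  (δ x v + δ y v) + indeg ((y , q) ∷ S) v
    ≡⟨ cong ((δ x v + δ y v) +_) (trans (indeg-∷ (y , q) S v) (sym (indeg-∷ (p , q) S v))) ⟩
  (δ x v + δ y v) + indeg ((p , q) ∷ S) v ∎
  where open ≡-Reasoning

path-outdeg : (p x y q : Fin m) (S : List (Arc m)) (v : Fin m) →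
  outdeg ((p , x) ∷ (x , y) ∷ (y , q) ∷ S) v ≡ (δ x v + δ y v) + outdeg ((p , q) ∷ S) v
path-outdeg p x y q S v = begin
  outdeg ((p , x) ∷ (x , y) ∷ (y , q) ∷ S) v
    ≡⟨ outdeg-∷ (p , x) _ v ⟩
  δ p v + outdeg ((x , y) ∷ (y , q) ∷ S) v
    ≡⟨ cong (δ p v +_) (trans (outdeg-∷ (x , y) _ v) (cong (δ x v +_) (outdeg-∷ (y , q) S v))) ⟩
  δ p v + (δ x v + (δ y v + outdeg S v))
    ≡⟨ cong (δ p v +_) (sym (ℕ.+-assoc (δ x v) _ _)) ⟩
  δ p v + ((δ x v + δ y v) + outdeg S v)
    ≡⟨ x∙yz≈y∙xz (δ p v) (δ x v + δ y v) (outdeg S v) ⟩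
  (δ x v + δ y v) + (δ p v + outdeg S v)
    ≡⟨ cong ((δ x v + δ y v) +_) (sym (outdeg-∷ (p , q) S v)) ⟩
  (δ x v + δ y v) + outdeg ((p , q) ∷ S) v ∎
  where open ≡-Reasoning

path-eulerian : (p x y q : Fin m) (S : List (Arc m)) →
  Eulerian ((p , x) ∷ (x , y) ∷ (y , q) ∷ S) → Eulerian ((p , q) ∷ S)
path-eulerian p x y q S eul v = ℕ.+-cancelˡ-≡ (δ x v + δ y v) _ _
  (trans (sym (path-indeg p x y q S v)) (trans (eul v) (path-outdeg p x y q S v)))

chord-eulerian : (p x y q : Fin m) (S : List (Arc m)) →
  Eulerian ((p , q) ∷ S) → Eulerian ((p , x) ∷ (x , y) ∷ (y , q) ∷ S)
chord-eulerian p x y q S eul v =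
  trans (path-indeg p x y q S v) (trans (cong (_ +_) (eul v)) (sym (path-outdeg p x y q S v)))

parity-3-1 : (k : ℕ) → (3 + k) % 2 ≡ (1 + k) % 2
parity-3-1 k = trans (cong (_% 2) (ℕ.+-comm 2 (suc k))) ([m+n]%n≡m%n (suc k) 2)

directed-count : {p x y q : Fin m} → Inner p x y q → {R : List (Arc m)} →
  All (Avoids x) R → All (Avoids y) R → (b : Bool) →
  eulerianCount b ((p , x) ∷ (x , y) ∷ (y , q) ∷ R) ≡ eulerianCount b ((p , q) ∷ R)
directed-count {p = p} {x} {y} {q} inner {R} avoidX avoidY b = begin
  eulerianCount b ((p , x) ∷ (x , y) ∷ (y , q) ∷ R)
    ≡⟨ eulerianCount-∷∷∷ b _ _ _ R ⟩
  _ ≡⟨ sum-first-last (eulerianCount b R) (withPrefix b ((p , x) ∷ (x , y) ∷ (y , q) ∷ []) R)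
         (withPrefix-unbalanced b avoidY (inj₂ (q≢y ∷ [] , here refl)))
         (withPrefix-unbalanced b avoidX (inj₂ (y≢x ∷ [] , here refl)))
         (withPrefix-unbalanced b avoidX (inj₂ (y≢x ∷ q≢x ∷ [] , here refl)))
         (withPrefix-unbalanced b avoidX (inj₁ (p≢x ∷ [] , here refl)))
         (withPrefix-unbalanced b avoidX (inj₁ (p≢x ∷ y≢x ∷ [] , here refl)))
         (withPrefix-unbalanced b avoidY (inj₁ (p≢y ∷ x≢y ∷ [] , there (here refl)))) ⟩
  eulerianCount b R + withPrefix b ((p , x) ∷ (x , y) ∷ (y , q) ∷ []) R
    ≡⟨ cong (eulerianCount b R +_) path≡chord ⟩
  eulerianCount b R + withPrefix b [ p , q ] R
    ≡⟨ sym (count-subsets-∷ (eulerianOfParity? b) (p , q) R) ⟩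
  eulerianCount b ((p , q) ∷ R) ∎
  where
  open ≡-Reasoning
  open Inner inner
  path≡chord : withPrefix b ((p , x) ∷ (x , y) ∷ (y , q) ∷ []) R ≡ withPrefix b [ p , q ] R
  path≡chord = count-cong {R = λ _ → ⊤} _ _
    (λ {S} _ → eulerianOfParity-transfer b (path-eulerian p x y q S) (parity-3-1 (length S)))
    (λ {S} _ → eulerianOfParity-transfer b (chord-eulerian p x y q S) (sym (parity-3-1 (length S))))
    (All.universal (λ _ → tt) (subsets R))

-- If both end arcs point inwards, x or y becomes a sink in every nonempty choice of
-- path arcs, so no Eulerian sub-digraph uses the path.
blocked-count : {p x y q : Fin m} → Inner p x y q → {R : List (Arc m)} →
  All (Avoids x) R → All (Avoids y) R → {t : Arc m} → SameEdge (x , y) t → (b : Bool) →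
  eulerianCount b ((p , x) ∷ t ∷ (q , y) ∷ R) ≡ eulerianCount b R
blocked-count {p = p} {x} {y} {q} inner {R} avoidX avoidY (inj₁ refl) b =
  trans (eulerianCount-∷∷∷ b _ _ _ R)
  (trans (sum-first-last (eulerianCount b R) _
           (withPrefix-unbalanced b avoidY (inj₁ (q≢y ∷ [] , here refl)))
           (withPrefix-unbalanced b avoidY (inj₁ (x≢y ∷ [] , here refl)))
           (withPrefix-unbalanced b avoidY (inj₁ (x≢y ∷ q≢y ∷ [] , here refl)))
           (withPrefix-unbalanced b avoidX (inj₁ (p≢x ∷ [] , here refl)))
           (withPrefix-unbalanced b avoidX (inj₁ (p≢x ∷ q≢x ∷ [] , here refl)))
           (withPrefix-unbalanced b avoidY (inj₁ (p≢y ∷ x≢y ∷ [] , there (here refl)))))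
  (trans (cong (eulerianCount b R +_)
           (withPrefix-unbalanced b avoidY (inj₁ (p≢y ∷ x≢y ∷ q≢y ∷ [] , there (here refl)))))
         (ℕ.+-identityʳ _)))
  where
  open Inner inner
blocked-count {p = p} {x} {y} {q} inner {R} avoidX avoidY (inj₂ refl) b =
  trans (eulerianCount-∷∷∷ b _ _ _ R)
  (trans (sum-first-last (eulerianCount b R) _
           (withPrefix-unbalanced b avoidY (inj₁ (q≢y ∷ [] , here refl)))
           (withPrefix-unbalanced b avoidX (inj₁ (y≢x ∷ [] , here refl)))
           (withPrefix-unbalanced b avoidX (inj₁ (y≢x ∷ q≢x ∷ [] , here refl)))
           (withPrefix-unbalanced b avoidX (inj₁ (p≢x ∷ [] , here refl)))
           (withPrefix-unbalanced b avoidX (inj₁ (p≢x ∷ q≢x ∷ [] , here refl)))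
           (withPrefix-unbalanced b avoidX (inj₁ (p≢x ∷ y≢x ∷ [] , here refl))))
  (trans (cong (eulerianCount b R +_)
           (withPrefix-unbalanced b avoidX (inj₁ (p≢x ∷ y≢x ∷ q≢x ∷ [] , here refl))))
         (ℕ.+-identityʳ _)))
  where
  open Inner inner

record Shifted (k : ℕ) (D : List (Arc m)) (w : Fin m) (D' : List (Arc n)) (v : Fin n) : Set where
  constructor shifted
  field
    outdeg-shift : outdeg D w ≡ k + outdeg D' v
    degree-shift : degree D w ≡ k + degree D' v

shifted-↭ˡ : {k : ℕ} {D₁ D₂ : List (Arc m)} {w : Fin m} {D' : List (Arc n)} {v : Fin n} →
             D₁ ↭ D₂ → Shifted k D₁ w D' v → Shifted k D₂ w D' v
shifted-↭ˡ {w = w} σ (shifted out≡ deg≡) =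
  shifted (trans (sym (outdeg-↭ σ w)) out≡) (trans (sym (degree-↭ σ w)) deg≡)

shifted-↭ʳ : {k : ℕ} {D : List (Arc m)} {w : Fin m} {D'₁ D'₂ : List (Arc n)} {v : Fin n} →
             D'₁ ↭ D'₂ → Shifted k D w D'₁ v → Shifted k D w D'₂ v
shifted-↭ʳ {k = k} {v = v} σ (shifted out≡ deg≡) =
  shifted (trans out≡ (cong (k +_) (outdeg-↭ σ v))) (trans deg≡ (cong (k +_) (degree-↭ σ v)))

path-degree : {p x y q : Fin m} {t₁ t₂ t₃ : Arc m} →
  SameEdge (p , x) t₁ → SameEdge (x , y) t₂ → SameEdge (y , q) t₃ → (L : List (Arc m)) (v : Fin m) →
  degree (t₁ ∷ t₂ ∷ t₃ ∷ L) v ≡ ends (p , x) v + (ends (x , y) v + (ends (y , q) v + degree L v))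
path-degree {t₁ = t₁} {t₂} {t₃} s₁ s₂ s₃ L v =
  trans (degree-∷ t₁ _ v) (cong₂ _+_ (ends-SameEdge s₁ v)
  (trans (degree-∷ t₂ _ v) (cong₂ _+_ (ends-SameEdge s₂ v)
  (trans (degree-∷ t₃ L v) (cong (_+ degree L v) (ends-SameEdge s₃ v))))))

path-degree-outer : {p x y q : Fin m} {t₁ t₂ t₃ : Arc m} →
  SameEdge (p , x) t₁ → SameEdge (x , y) t₂ → SameEdge (y , q) t₃ → (L : List (Arc m)) →
  {v : Fin m} → v ≢ x → v ≢ y → degree (t₁ ∷ t₂ ∷ t₃ ∷ L) v ≡ ends (p , q) v + degree L v
path-degree-outer {p = p} {x} {y} {q} s₁ s₂ s₃ L {v} v≢x v≢y
  rewrite path-degree s₁ s₂ s₃ L v | δ-other (≢-sym v≢x) | δ-other (≢-sym v≢y) =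
  trans (cong (_+ (δ q v + degree L v)) (ℕ.+-identityʳ (δ p v))) (sym (ℕ.+-assoc (δ p v) _ _))

path-degree-x : {p x y q : Fin m} → Inner p x y q → {t₁ t₂ t₃ : Arc m} →
  SameEdge (p , x) t₁ → SameEdge (x , y) t₂ → SameEdge (y , q) t₃ → (L : List (Arc m)) →
  degree (t₁ ∷ t₂ ∷ t₃ ∷ L) x ≡ 2 + degree L x
path-degree-x {x = x} inner s₁ s₂ s₃ L
  rewrite path-degree s₁ s₂ s₃ L x | δ-other (Inner.p≢x inner) | δ-self x
        | δ-other (Inner.y≢x inner) | δ-other (Inner.q≢x inner) = refl

path-degree-y : {p x y q : Fin m} → Inner p x y q → {t₁ t₂ t₃ : Arc m} →
  SameEdge (p , x) t₁ → SameEdge (x , y) t₂ → SameEdge (y , q) t₃ → (L : List (Arc m)) →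
  degree (t₁ ∷ t₂ ∷ t₃ ∷ L) y ≡ 2 + degree L y
path-degree-y {y = y} inner s₁ s₂ s₃ L
  rewrite path-degree s₁ s₂ s₃ L y | δ-other (Inner.p≢y inner) | δ-other (Inner.x≢y inner)
        | δ-self y | δ-other (Inner.q≢y inner) = refl

directed-shift : {p x y q : Fin m} (R : List (Arc m)) {v : Fin m} → v ≢ x → v ≢ y →
  Shifted 0 ((p , x) ∷ (x , y) ∷ (y , q) ∷ R) v ((p , q) ∷ R) v
directed-shift {p = p} {x} {y} {q} R {v} v≢x v≢y =
  shifted (trans (path-outdeg p x y q R v) (cong (_+ outdeg ((p , q) ∷ R) v) offset≡0))
  (trans (path-degree-outer (inj₁ refl) (inj₁ refl) (inj₁ refl) R v≢x v≢y) (sym (degree-∷ (p , q) R v)))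
  where
  offset≡0 : δ x v + δ y v ≡ 0
  offset≡0 = cong₂ _+_ (δ-other (≢-sym v≢x)) (δ-other (≢-sym v≢y))

blocked-shift : {p x y q : Fin m} {t : Arc m} → SameEdge (x , y) t → (R : List (Arc m)) →
  {v : Fin m} → v ≢ x → v ≢ y → Shifted (ends (p , q) v) ((p , x) ∷ t ∷ (q , y) ∷ R) v R v
blocked-shift {p = p} {x} {y} {q} {t} s R {v} v≢x v≢y =
  shifted out (path-degree-outer (inj₁ refl) s (inj₂ refl) R v≢x v≢y)
  where
  open ≡-Reasoning
  t-avoids : Avoids v t
  t-avoids = avoids-SameEdge s ((≢-sym v≢x) , (≢-sym v≢y))
  out : outdeg ((p , x) ∷ t ∷ (q , y) ∷ R) v ≡ ends (p , q) v + outdeg R v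
  out = begin
    outdeg ((p , x) ∷ t ∷ (q , y) ∷ R) v
      ≡⟨ outdeg-∷ (p , x) _ v ⟩
    δ p v + outdeg (t ∷ (q , y) ∷ R) v
      ≡⟨ cong (δ p v +_) (outdeg-∷ t _ v) ⟩
    δ p v + (δ (proj₁ t) v + outdeg ((q , y) ∷ R) v)
      ≡⟨ cong (λ k → δ p v + (k + outdeg ((q , y) ∷ R) v)) (δ-other (proj₁ t-avoids)) ⟩
    δ p v + outdeg ((q , y) ∷ R) v
      ≡⟨ cong (δ p v +_) (outdeg-∷ (q , y) R v) ⟩
    δ p v + (δ q v + outdeg R v)
      ≡⟨ sym (ℕ.+-assoc (δ p v) _ _) ⟩
    ends (p , q) v + outdeg R v ∎

leaves-twice : (v a b : Fin m) (L : List (Arc m)) → 2 ≤ outdeg ((v , a) ∷ (v , b) ∷ L) v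
leaves-twice v a b L
  rewrite outdeg-∷ (v , a) ((v , b) ∷ L) v | outdeg-∷ (v , b) L v | δ-self v = s≤s (s≤s z≤n)

outdeg-∷-≥ : (e : Arc m) (L : List (Arc m)) (v : Fin m) → outdeg L v ≤ outdeg (e ∷ L) v
outdeg-∷-≥ e L v = subst (outdeg L v ≤_) (sym (outdeg-∷ e L v)) (ℕ.m≤n+m _ _)

reverse-three : (a b c : A) (L : List A) → a ∷ b ∷ c ∷ L ↭ c ∷ b ∷ a ∷ L
reverse-three a b c L =
  ↭.trans (↭.swap a b ↭.refl) (↭.trans (prep b (↭.swap a c ↭.refl)) (↭.swap b c ↭.refl))

data PathReduction (p q x y : Fin m) (D R : List (Arc m)) : Set where
  directed : (c : Arc m) → SameEdge (p , q) c →
             ((b : Bool) → eulerianCount b D ≡ eulerianCount b (c ∷ R)) →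
             ((v : Fin m) → v ≢ x → v ≢ y → Shifted 0 D v (c ∷ R) v) →
             PathReduction p q x y D R
  blocked : ((b : Bool) → eulerianCount b D ≡ eulerianCount b R) →
            ((v : Fin m) → v ≢ x → v ≢ y → Shifted (ends (p , q) v) D v R v) →
            PathReduction p q x y D R

pathReduction : {p x y q : Fin m} → Inner p x y q → {t₁ t₂ t₃ : Arc m} →
  SameEdge (p , x) t₁ → SameEdge (x , y) t₂ → SameEdge (y , q) t₃ →
  {R : List (Arc m)} → All (Avoids x) R → All (Avoids y) R →
  outdeg (t₁ ∷ t₂ ∷ t₃ ∷ R) x ≤ 1 → outdeg (t₁ ∷ t₂ ∷ t₃ ∷ R) y ≤ 1 →
  PathReduction p q x y (t₁ ∷ t₂ ∷ t₃ ∷ R) R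
pathReduction inner (inj₁ refl) (inj₁ refl) (inj₁ refl) {R} avoidX avoidY _ _ =
  directed _ (inj₁ refl) (directed-count inner avoidX avoidY) (λ v → directed-shift R)
pathReduction inner (inj₂ refl) (inj₂ refl) (inj₂ refl) {R} avoidX avoidY _ _ =
  directed _ (inj₂ refl)
    (λ b → trans (eulerianCount-↭ (reverse-three _ _ _ R) b)
                 (directed-count (Inner.reversed inner) avoidY avoidX b))
    (λ v v≢x v≢y → shifted-↭ˡ (↭-sym (reverse-three _ _ _ R)) (directed-shift R v≢y v≢x))
pathReduction inner (inj₁ refl) s₂ (inj₂ refl) {R} avoidX avoidY _ _ =
  blocked (blocked-count inner avoidX avoidY s₂) (λ v → blocked-shift s₂ R)
pathReduction {x = x} inner {t₃ = t₃} (inj₂ refl) (inj₁ refl) _ {R} _ _ outX≤1 _ =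
  ⊥-elim (ℕ.<-irrefl refl (ℕ.≤-trans (leaves-twice x _ _ (t₃ ∷ R)) outX≤1))
pathReduction {y = y} inner {t₁} s₁ (inj₂ refl) (inj₁ refl) {R} _ _ _ outY≤1 =
  ⊥-elim (ℕ.<-irrefl refl
    (ℕ.≤-trans (leaves-twice y _ _ R) (ℕ.≤-trans (outdeg-∷-≥ t₁ _ y) outY≤1)))

-- Transferring AT orientations between graphs.

Bounded : Graph m → (Fin m → ℕ) → List (Arc m) → Set
Bounded {m} G h D = (v : Fin m) → V G v ≡ true → outdeg D v + h v + 1 ≤ deg G v

degree-avoid : {v : Fin m} {L : List (Arc m)} → All (Avoids v) L → degree L v ≡ 0
degree-avoid avoid = cong₂ _+_ (outdeg-avoid avoid) (indeg-avoid avoid)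

orientation-↭ : {R : A → B → Set} {E E' : List A} {D : List B} → E ↭ E' → Pointwise R E D →
                Σ[ D' ∈ List B ] Pointwise R E' D' × D ↭ D'
orientation-↭ ↭.refl rs = _ , rs , ↭.refl
orientation-↭ (prep x σ) (r ∷ rs) with orientation-↭ σ rs
... | D' , rs' , τ = _ ∷ D' , r ∷ rs' , prep _ τ
orientation-↭ (↭.swap x y σ) (r ∷ r' ∷ rs) with orientation-↭ σ rs
... | D' , rs' , τ = _ ∷ _ ∷ D' , r' ∷ r ∷ rs' , ↭.swap _ _ τ
orientation-↭ (↭.trans σ τ) rs with orientation-↭ σ rs
... | D' , rs' , σ' with orientation-↭ τ rs'
... | D'' , rs'' , τ' = D'' , rs'' , ↭.trans σ' τ'

-- the out-degree bound at a vertex of degree two with h = 0 allows at most one out-arc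
at-most-one : {o k d : ℕ} → o + k + 1 ≤ d → k ≡ 0 → d ≡ 2 → o ≤ 1
at-most-one {o} bound refl refl =
  ℕ.≤-pred (subst (_≤ 2) (trans (cong (_+ 1) (ℕ.+-identityʳ o)) (ℕ.+-comm o 1)) bound)

Corresponding : Graph m → (Fin m → ℕ) → List (Arc m) → (Fin n → ℕ) → List (Arc n) → Fin n → Set
Corresponding {m} G h D h' D' v =
  Σ[ w ∈ Fin m ] Σ[ k ∈ ℕ ] V G w ≡ true × h w ≡ h' v × Shifted k D w D' v

AT-transfer : {G : Graph m} {h : Fin m → ℕ} {G' : Graph n} {h' : Fin n → ℕ}
  {D : List (Arc m)} {D' : List (Arc n)} →
  IsOrientation G D → IsATOrientation D → Bounded G h D →
  IsOrientation G' D' → ((b : Bool) → eulerianCount b D' ≡ eulerianCount b D) →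
  ((v : Fin n) → V G' v ≡ true → Corresponding G h D h' D' v) →
  AT G' h'
AT-transfer {m} {n} {G} {h} {G'} {h'} {D} {D'} orient at bound orient' same corr =
  D' , orient' , AT-orientation-transfer {D = D'} {D} same at , bound'
  where
  bound' : Bounded G' h' D'
  bound' v Vv with corr v Vv
  ... | w , k , Vw , hw≡h'v , shifted out≡ deg≡ =
    ℕ.+-cancelˡ-≤ k _ _ (subst₂ _≤_ lhs rhs (bound w Vw))
    where
    open ≡-Reasoning
    lhs : outdeg D w + h w + 1 ≡ k + (outdeg D' v + h' v + 1)
    lhs = begin
      outdeg D w + h w + 1           ≡⟨ cong₂ (λ a b → a + b + 1) out≡ hw≡h'v ⟩
      k + outdeg D' v + h' v + 1     ≡⟨ cong (_+ 1) (ℕ.+-assoc k _ _) ⟩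
      k + (outdeg D' v + h' v) + 1   ≡⟨ ℕ.+-assoc k _ 1 ⟩
      k + (outdeg D' v + h' v + 1)   ∎
    rhs : deg G w ≡ k + deg G' v
    rhs = trans (sym (degree-orientation orient w))
                (trans deg≡ (cong (k +_) (degree-orientation orient' v)))

lift-outdeg : (L : List (Arc n)) (v : Fin n) → outdeg (map liftA L) (liftV v) ≡ outdeg L v
lift-outdeg []      v = refl
lift-outdeg (e ∷ L) v =
  trans (outdeg-∷ (liftA e) _ (liftV v))
        (trans (cong (δ (proj₁ e) v +_) (lift-outdeg L v)) (sym (outdeg-∷ e L v)))

lift-indeg : (L : List (Arc n)) (v : Fin n) → indeg (map liftA L) (liftV v) ≡ indeg L v
lift-indeg []      v = refl
lift-indeg (e ∷ L) v =
  trans (indeg-∷ (liftA e) _ (liftV v))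
        (trans (cong (δ (proj₂ e) v +_) (lift-indeg L v)) (sym (indeg-∷ e L v)))

lift-avoids : {w : Fin (suc (suc n))} → (∀ v → liftV v ≢ w) → (L : List (Arc n)) →
              All (Avoids w) (map liftA L)
lift-avoids new []      = []
lift-avoids new (e ∷ L) = (new (proj₁ e) , new (proj₂ e)) ∷ lift-avoids new L

shifted-unlift : {k : ℕ} {D : List (Arc m)} {w : Fin m} {L : List (Arc n)} {v : Fin n} →
                 Shifted k D w (map liftA L) (liftV v) → Shifted k D w L v
shifted-unlift {k = k} {L = L} {v} (shifted out≡ deg≡) =
  shifted (trans out≡ (cong (k +_) (lift-outdeg L v)))
          (trans deg≡ (cong (k +_) (cong₂ _+_ (lift-outdeg L v) (lift-indeg L v))))

lift-eulerian : (S : List (Arc n)) → Eulerian S → Eulerian (map liftA S)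
lift-eulerian S eul zero =
  trans (indeg-avoid (lift-avoids (λ _ ()) S)) (sym (outdeg-avoid (lift-avoids (λ _ ()) S)))
lift-eulerian S eul (suc zero) =
  trans (indeg-avoid (lift-avoids (λ _ ()) S)) (sym (outdeg-avoid (lift-avoids (λ _ ()) S)))
lift-eulerian S eul (suc (suc v)) = trans (lift-indeg S v) (trans (eul v) (sym (lift-outdeg S v)))

unlift-eulerian : (S : List (Arc n)) → Eulerian (map liftA S) → Eulerian S
unlift-eulerian S eul v = trans (sym (lift-indeg S v)) (trans (eul (liftV v)) (lift-outdeg S v))

lift-count : (b : Bool) (D : List (Arc n)) → eulerianCount b (map liftA D) ≡ eulerianCount b D
lift-count b D = begin
  count P? (subsets (map liftA D))            ≡⟨ cong (count P?) (subsets-map liftA D) ⟩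
  count P? (map (map liftA) (subsets D))      ≡⟨ count-map P? (map liftA) (subsets D) ⟩
  count (λ S → P? (map liftA S)) (subsets D)  ≡⟨ count-cong {R = λ _ → ⊤} _ P? unlifted lifted
                                                   (All.universal (λ _ → tt) (subsets D)) ⟩
  count P? (subsets D)                        ∎
  where
  open ≡-Reasoning
  P? : {k : ℕ} → Decidable (EulerianOfParity {k} b)
  P? = eulerianOfParity? b
  unlifted : {S : List (Arc _)} → ⊤ → EulerianOfParity b (map liftA S) → EulerianOfParity b S
  unlifted {S} _ = eulerianOfParity-transfer b (unlift-eulerian S) (cong (_% 2) (length-map liftA S))
  lifted : {S : List (Arc _)} → ⊤ → EulerianOfParity b S → EulerianOfParity b (map liftA S)
  lifted {S} _ = eulerianOfParity-transfer b (lift-eulerian S) (cong (_% 2) (sym (length-map liftA S)))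

unlift-arc : {e : Arc n} {c : Arc (suc (suc n))} → SameEdge (liftA e) c →
             Σ[ c₀ ∈ Arc n ] SameEdge e c₀ × c ≡ liftA c₀
unlift-arc (inj₁ refl) = _ , inj₁ refl , refl
unlift-arc (inj₂ refl) = _ , inj₂ refl , refl

unlift : {X : List (Arc n)} {Y : List (Arc (suc (suc n)))} → Pointwise SameEdge (map liftA X) Y →
         Σ[ Y₀ ∈ List (Arc n) ] Pointwise SameEdge X Y₀ × Y ≡ map liftA Y₀
unlift {X = []}    []       = [] , [] , refl
unlift {X = e ∷ X} (s ∷ ss) with unlift-arc s | unlift ss
... | c₀ , s₀ , refl | Y₀ , ss₀ , refl = c₀ ∷ Y₀ , s₀ ∷ ss₀ , refl

Pointwise-++⁻ : {R : A → B → Set} (xs : List A) {ys : List A} {zs : List B} →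
  Pointwise R (xs ++ ys) zs →
  Σ[ zs₁ ∈ List B ] Σ[ zs₂ ∈ List B ] zs ≡ zs₁ ++ zs₂ × Pointwise R xs zs₁ × Pointwise R ys zs₂
Pointwise-++⁻ []       rs       = [] , _ , refl , [] , rs
Pointwise-++⁻ (x ∷ xs) (r ∷ rs) with Pointwise-++⁻ xs rs
... | zs₁ , zs₂ , refl , rs₁ , rs₂ = _ ∷ zs₁ , zs₂ , refl , r ∷ rs₁ , rs₂

removeAt-↭ : (xs : List A) (i : Fin (length xs)) → xs ↭ lookup xs i ∷ removeAt xs i
removeAt-↭ (x ∷ xs) zero    = ↭.refl
removeAt-↭ (x ∷ xs) (suc i) = ↭.trans (prep x (removeAt-↭ xs i)) (↭.swap x _ ↭.refl)

-- Part (a): stretching the edge e = u₁u₂ into the path u₁ – w₁ – w₂ – u₂.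

module Stretching {n : ℕ} (G : Graph n) (h : Fin n → ℕ) (i : Fin (length (E G))) where

  e : Arc n
  e = lookup (E G) i

  rest : List (Arc n)
  rest = removeAt (E G) i

  G' : Graph (suc (suc n))
  G' = stretchGraph G i

  w₁ w₂ : Fin (suc (suc n))
  w₁ = zero
  w₂ = suc zero

  inner : Inner (liftV (proj₁ e)) w₁ w₂ (liftV (proj₂ e))
  inner = record { p≢x = λ () ; p≢y = λ () ; q≢x = λ () ; q≢y = λ () ; x≢y = λ () }

  deg-w₁ : deg G' w₁ ≡ 2
  deg-w₁ = trans (degree-++ (map liftA rest) _ w₁)
                 (cong (_+ 2) (degree-avoid (lift-avoids (λ _ ()) rest)))

  deg-w₂ : deg G' w₂ ≡ 2
  deg-w₂ = trans (degree-++ (map liftA rest) _ w₂)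
                 (cong (_+ 2) (degree-avoid (lift-avoids (λ _ ()) rest)))

  module _ {D₀ : List (Arc n)} {t₁ t₂ t₃ : Arc (suc (suc n))}
           (orient' : IsOrientation G' (map liftA D₀ ++ t₁ ∷ t₂ ∷ t₃ ∷ []))
           (at' : IsATOrientation (map liftA D₀ ++ t₁ ∷ t₂ ∷ t₃ ∷ []))
           (bound' : Bounded G' (stretchH h) (map liftA D₀ ++ t₁ ∷ t₂ ∷ t₃ ∷ [])) where

    σ : map liftA D₀ ++ t₁ ∷ t₂ ∷ t₃ ∷ [] ↭ t₁ ∷ t₂ ∷ t₃ ∷ map liftA D₀
    σ = ++-comm (map liftA D₀) _

    from-directed : (c : Arc (suc (suc n))) → SameEdge (liftA e) c →
      ((b : Bool) → eulerianCount b (t₁ ∷ t₂ ∷ t₃ ∷ map liftA D₀) ≡ eulerianCount b (c ∷ map liftA D₀)) →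
      ((v : Fin (suc (suc n))) → v ≢ w₁ → v ≢ w₂ →
         Shifted 0 (t₁ ∷ t₂ ∷ t₃ ∷ map liftA D₀) v (c ∷ map liftA D₀) v) →
      Pointwise SameEdge rest D₀ → AT G h
    from-directed c s same shift orient₀ with unlift-arc s
    ... | c₀ , s₀ , refl with orientation-↭ (↭-sym (removeAt-↭ (E G) i)) (s₀ ∷ orient₀)
    ... | D , orient , τ = AT-transfer orient' at' bound' orient same' corr
      where
      same' : (b : Bool) → eulerianCount b D ≡ eulerianCount b (map liftA D₀ ++ t₁ ∷ t₂ ∷ t₃ ∷ [])
      same' b = begin
        eulerianCount b D                                ≡⟨ eulerianCount-↭ (↭-sym τ) b ⟩
        eulerianCount b (c₀ ∷ D₀)                        ≡⟨ sym (lift-count b (c₀ ∷ D₀)) ⟩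
        eulerianCount b (liftA c₀ ∷ map liftA D₀)        ≡⟨ sym (same b) ⟩
        eulerianCount b (t₁ ∷ t₂ ∷ t₃ ∷ map liftA D₀)    ≡⟨ eulerianCount-↭ (↭-sym σ) b ⟩
        eulerianCount b (map liftA D₀ ++ t₁ ∷ t₂ ∷ t₃ ∷ []) ∎
        where open ≡-Reasoning
      corr : (v : Fin n) → V G v ≡ true →
             Corresponding G' (stretchH h) (map liftA D₀ ++ t₁ ∷ t₂ ∷ t₃ ∷ []) h D v
      corr v Vv = liftV v , 0 , Vv , refl ,
        shifted-↭ˡ (↭-sym σ) (shifted-↭ʳ τ (shifted-unlift (shift (liftV v) (λ ()) (λ ()))))

    from-blocked :
      ((b : Bool) → eulerianCount b (t₁ ∷ t₂ ∷ t₃ ∷ map liftA D₀) ≡ eulerianCount b (map liftA D₀)) →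
      ((v : Fin (suc (suc n))) → v ≢ w₁ → v ≢ w₂ →
         Shifted (ends (liftA e) v) (t₁ ∷ t₂ ∷ t₃ ∷ map liftA D₀) v (map liftA D₀) v) →
      Pointwise SameEdge rest D₀ → AT (deleteEdge G i) h
    from-blocked same shift orient₀ = AT-transfer orient' at' bound' orient₀ same' corr
      where
      same' : (b : Bool) → eulerianCount b D₀ ≡ eulerianCount b (map liftA D₀ ++ t₁ ∷ t₂ ∷ t₃ ∷ [])
      same' b = trans (sym (lift-count b D₀)) (trans (sym (same b)) (eulerianCount-↭ (↭-sym σ) b))
      corr : (v : Fin n) → V G v ≡ true →
             Corresponding G' (stretchH h) (map liftA D₀ ++ t₁ ∷ t₂ ∷ t₃ ∷ []) h D₀ v
      corr v Vv = liftV v , ends e v , Vv , refl ,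
        shifted-↭ˡ (↭-sym σ) (shifted-unlift (shift (liftV v) (λ ()) (λ ())))

  stretch-non-AT : ¬ AT G h → ¬ AT (deleteEdge G i) h → ¬ AT G' (stretchH h)
  stretch-non-AT ¬AT-G ¬AT-G-e (D' , orient' , at' , bound')
    with Pointwise-++⁻ (map liftA rest) orient'
  ... | _ , t₁ ∷ t₂ ∷ t₃ ∷ [] , refl , orientRest , s₁ ∷ s₂ ∷ s₃ ∷ []
    with unlift orientRest
  ... | D₀ , orient₀ , refl
    with pathReduction inner s₁ s₂ s₃ (lift-avoids (λ _ ()) D₀) (lift-avoids (λ _ ()) D₀)
           (subst (_≤ 1) (outdeg-↭ (σ orient' at' bound') w₁)
                  (at-most-one (bound' w₁ refl) refl deg-w₁))
           (subst (_≤ 1) (outdeg-↭ (σ orient' at' bound') w₂)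
                  (at-most-one (bound' w₂ refl) refl deg-w₂))
  ... | directed c s same shift = ¬AT-G (from-directed orient' at' bound' c s same shift orient₀)
  ... | blocked same shift      = ¬AT-G-e (from-blocked orient' at' bound' same shift orient₀)

-- Part (b): suppressing a path u₁ – v₁ – v₂ – u₂ whose inner vertices have degree two.

adj⇒edge : {G : Graph n} {a b : Fin n} → Adj G a b → Σ[ e ∈ Arc n ] SameEdge (a , b) e × e ∈ E G
adj⇒edge (inj₁ ab∈E) = _ , inj₁ refl , ab∈E
adj⇒edge (inj₂ ba∈E) = _ , inj₂ refl , ba∈E

SameEdge-trans : {a b c : Arc n} → SameEdge a b → SameEdge b c → SameEdge a c
SameEdge-trans (inj₁ refl) s           = s
SameEdge-trans (inj₂ refl) (inj₁ refl) = inj₂ refl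
SameEdge-trans (inj₂ refl) (inj₂ refl) = inj₁ refl

has-end : {a b : Fin n} {e : Arc n} → SameEdge (a , b) e → ¬ Avoids a e
has-end (inj₁ refl) (a≢a , _) = a≢a refl
has-end (inj₂ refl) (_ , a≢a) = a≢a refl

≢-by-end : {w : Fin n} {e e' : Arc n} → Avoids w e' → ¬ Avoids w e → e ≢ e'
≢-by-end avoid ¬avoid refl = ¬avoid avoid

∈⇒↭ : {x : A} {xs : List A} → x ∈ xs → Σ[ ys ∈ List A ] xs ↭ x ∷ ys
∈⇒↭ x∈xs with ∈-∃++ x∈xs
... | ys , zs , refl = ys ++ zs , shift _ ys zs

∈-behind : {x y : A} {xs ys : List A} → x ∈ xs → xs ↭ y ∷ ys → x ≢ y → x ∈ ys
∈-behind x∈xs σ x≢y with ∈-resp-↭ σ x∈xs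
... | here x≡y   = ⊥-elim (x≢y x≡y)
... | there x∈ys = x∈ys

front-three : {x y z : A} {xs : List A} → x ∈ xs → y ∈ xs → z ∈ xs → x ≢ y → x ≢ z → y ≢ z →
              Σ[ ws ∈ List A ] xs ↭ x ∷ y ∷ z ∷ ws
front-three {x = x} {y} x∈ y∈ z∈ x≢y x≢z y≢z with ∈⇒↭ x∈
... | ys , σ with ∈⇒↭ (∈-behind y∈ σ (≢-sym x≢y))
... | zs , τ with ∈⇒↭ (∈-behind (∈-behind z∈ σ (≢-sym x≢z)) τ (≢-sym y≢z))
... | ws , ρ = ws , ↭.trans σ (prep x (↭.trans τ (prep y ρ)))

-- the test deleteVertex uses to keep an edge
avoids? : (v : Fin m) → Decidable (Avoids v)
avoids? v e = ¬? (proj₁ e Fin.≟ v) ×-dec ¬? (proj₂ e Fin.≟ v)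

deleteVertex-V : (G : Graph n) {v w : Fin n} → V (deleteVertex G v) w ≡ true → V G w ≡ true × w ≢ v
deleteVertex-V G {v} {w} Vw with w Fin.≟ v
deleteVertex-V G () | yes _
... | no w≢v = Vw , w≢v

filter-path : {p x y q : Fin m} → Inner p x y q → {t₁ t₂ t₃ : Arc m} →
  SameEdge (p , x) t₁ → SameEdge (x , y) t₂ → SameEdge (y , q) t₃ →
  {L : List (Arc m)} → All (Avoids x) L → All (Avoids y) L →
  filter (avoids? y) (filter (avoids? x) (t₁ ∷ t₂ ∷ t₃ ∷ L)) ≡ L
filter-path {x = x} {y} inner {t₁} {t₂} {t₃} s₁ s₂ s₃ {L} avoidX avoidY = begin
  filter (avoids? y) (filter (avoids? x) (t₁ ∷ t₂ ∷ t₃ ∷ L))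
    ≡⟨ cong (filter (avoids? y)) (begin
         filter (avoids? x) (t₁ ∷ t₂ ∷ t₃ ∷ L)
           ≡⟨ filter-reject (avoids? x) (has-end (SameEdge-trans (inj₂ refl) s₁)) ⟩
         filter (avoids? x) (t₂ ∷ t₃ ∷ L)
           ≡⟨ filter-reject (avoids? x) (has-end s₂) ⟩
         filter (avoids? x) (t₃ ∷ L)
           ≡⟨ filter-accept (avoids? x) (avoids-SameEdge s₃ (y≢x , q≢x)) ⟩
         t₃ ∷ filter (avoids? x) L
           ≡⟨ cong (t₃ ∷_) (filter-all (avoids? x) avoidX) ⟩
         t₃ ∷ L ∎) ⟩
  filter (avoids? y) (t₃ ∷ L)
    ≡⟨ filter-reject (avoids? y) (has-end s₃) ⟩
  filter (avoids? y) L
    ≡⟨ filter-all (avoids? y) avoidY ⟩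
  L ∎
  where
  open ≡-Reasoning
  open Inner inner

module Suppression {n : ℕ} (G : Graph n) (h : Fin n → ℕ) {u₁ v₁ v₂ u₂ : Fin n}
                   (inner : Inner u₁ v₁ v₂ u₂) where

  G₂ : Graph n
  G₂ = deleteVertex (deleteVertex G v₁) v₂

  G⁺ : Graph n
  G⁺ = addEdge G₂ u₁ u₂

  V-G₂ : {v : Fin n} → V G₂ v ≡ true → V G v ≡ true × v ≢ v₁ × v ≢ v₂
  V-G₂ Vv with deleteVertex-V (deleteVertex G v₁) Vv
  ... | Vv' , v≢v₂ with deleteVertex-V G Vv'
  ... | VGv , v≢v₁ = VGv , v≢v₁ , v≢v₂

  module _ {D D₃ F : List (Arc n)} {t₁ t₂ t₃ : Arc n}
           (orient : IsOrientation G D) (at : IsATOrientation D) (bound : Bounded G h D)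
           (σ : D ↭ t₁ ∷ t₂ ∷ t₃ ∷ D₃) (orientF : IsOrientation G₂ F) (τ : D₃ ↭ F) where

    from-directed : (c : Arc n) → SameEdge (u₁ , u₂) c →
      ((b : Bool) → eulerianCount b (t₁ ∷ t₂ ∷ t₃ ∷ D₃) ≡ eulerianCount b (c ∷ D₃)) →
      ((v : Fin n) → v ≢ v₁ → v ≢ v₂ → Shifted 0 (t₁ ∷ t₂ ∷ t₃ ∷ D₃) v (c ∷ D₃) v) →
      AT G⁺ h
    from-directed c s same shift = AT-transfer orient at bound (s ∷ orientF) same' corr
      where
      same' : (b : Bool) → eulerianCount b (c ∷ F) ≡ eulerianCount b D
      same' b = trans (eulerianCount-↭ (prep c (↭-sym τ)) b)
                      (trans (sym (same b)) (eulerianCount-↭ (↭-sym σ) b))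
      corr : (v : Fin n) → V G⁺ v ≡ true → Corresponding G h D h (c ∷ F) v
      corr v Vv with V-G₂ Vv
      ... | VGv , v≢v₁ , v≢v₂ =
        v , 0 , VGv , refl , shifted-↭ˡ (↭-sym σ) (shifted-↭ʳ (prep c τ) (shift v v≢v₁ v≢v₂))

    from-blocked :
      ((b : Bool) → eulerianCount b (t₁ ∷ t₂ ∷ t₃ ∷ D₃) ≡ eulerianCount b D₃) →
      ((v : Fin n) → v ≢ v₁ → v ≢ v₂ → Shifted (ends (u₁ , u₂) v) (t₁ ∷ t₂ ∷ t₃ ∷ D₃) v D₃ v) →
      AT G₂ h
    from-blocked same shift = AT-transfer orient at bound orientF same' corr
      where
      same' : (b : Bool) → eulerianCount b F ≡ eulerianCount b D
      same' b = trans (eulerianCount-↭ (↭-sym τ) b)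
                      (trans (sym (same b)) (eulerianCount-↭ (↭-sym σ) b))
      corr : (v : Fin n) → V G₂ v ≡ true → Corresponding G h D h F v
      corr v Vv with V-G₂ Vv
      ... | VGv , v≢v₁ , v≢v₂ =
        v , ends (u₁ , u₂) v , VGv , refl , shifted-↭ˡ (↭-sym σ) (shifted-↭ʳ τ (shift v v≢v₁ v≢v₂))

  rest-avoids : {e₁ e₂ e₃ : Arc n} →
    SameEdge (u₁ , v₁) e₁ → SameEdge (v₁ , v₂) e₂ → SameEdge (v₂ , u₂) e₃ →
    {E₃ : List (Arc n)} → E G ↭ e₁ ∷ e₂ ∷ e₃ ∷ E₃ → deg G v₁ ≡ 2 → deg G v₂ ≡ 2 →
    All (Avoids v₁) E₃ × All (Avoids v₂) E₃
  rest-avoids s₁ s₂ s₃ {E₃} σ deg₁ deg₂ =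
    degree-zero⇒avoid E₃ (ℕ.+-cancelˡ-≡ 2 _ 0
      (trans (sym (path-degree-x inner s₁ s₂ s₃ E₃)) (trans (sym (degree-↭ σ v₁)) deg₁))) ,
    degree-zero⇒avoid E₃ (ℕ.+-cancelˡ-≡ 2 _ 0
      (trans (sym (path-degree-y inner s₁ s₂ s₃ E₃)) (trans (sym (degree-↭ σ v₂)) deg₂)))

  suppress : u₁ ≢ u₂ → Adj G u₁ v₁ → Adj G v₁ v₂ → Adj G v₂ u₂ →
    V G v₁ ≡ true → V G v₂ ≡ true → deg G v₁ ≡ 2 → deg G v₂ ≡ 2 → h v₁ ≡ 0 → h v₂ ≡ 0 →
    AT G h → ¬ AT G₂ h → AT G⁺ h
  suppress u₁≢u₂ adj₁ adj₂ adj₃ Vv₁ Vv₂ deg₁ deg₂ h₁ h₂ (D , orient , at , bound) ¬AT-G₂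
    with adj⇒edge {G = G} adj₁ | adj⇒edge {G = G} adj₂ | adj⇒edge {G = G} adj₃
  ... | e₁ , s₁ , e₁∈ | e₂ , s₂ , e₂∈ | e₃ , s₃ , e₃∈
    with front-three e₁∈ e₂∈ e₃∈
           (≢-by-end (avoids-SameEdge s₂ (≢-sym p≢x , ≢-sym p≢y)) (has-end s₁))
           (≢-by-end (avoids-SameEdge s₃ (≢-sym p≢y , ≢-sym u₁≢u₂)) (has-end s₁))
           (≢-by-end (avoids-SameEdge s₃ (y≢x , q≢x)) (has-end s₂))
    where open Inner inner
  ... | E₃ , σE
    with rest-avoids s₁ s₂ s₃ σE deg₁ deg₂ | orientation-↭ σE orient
  ... | avoid₁ , avoid₂ | t₁ ∷ t₂ ∷ t₃ ∷ D₃ , r₁ ∷ r₂ ∷ r₃ ∷ orient₃ , σD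
    with orientation-↭ (↭.trans (↭-reflexive (sym (filter-path inner s₁ s₂ s₃ avoid₁ avoid₂)))
                                (↭-sym (filter-↭ (avoids? v₂) (filter-↭ (avoids? v₁) σE))))
                       orient₃
  ... | F , orientF , τ
    with pathReduction inner (SameEdge-trans s₁ r₁) (SameEdge-trans s₂ r₂) (SameEdge-trans s₃ r₃)
           (All-resp-Pointwise avoids-SameEdge orient₃ avoid₁)
           (All-resp-Pointwise avoids-SameEdge orient₃ avoid₂)
           (subst (_≤ 1) (outdeg-↭ σD v₁) (at-most-one (bound v₁ Vv₁) h₁ deg₁))
           (subst (_≤ 1) (outdeg-↭ σD v₂) (at-most-one (bound v₂ Vv₂) h₂ deg₂))
  ... | directed c s same shift = from-directed orient at bound σD orientF τ c s same shift
  ... | blocked same shift = ⊥-elim (¬AT-G₂ (from-blocked orient at bound σD orientF τ same shift))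

corollary2 :
    ((n : ℕ) (G : Graph n) (h : Fin n → ℕ) → Simple G →
       (i : Fin (length (E G))) →
       ¬ AT G h → ¬ AT (deleteEdge G i) h →
       ¬ AT (stretchGraph G i) (stretchH h))
    ×
    ((n : ℕ) (G : Graph n) (h : Fin n → ℕ) → Simple G →
       (u₁ v₁ v₂ u₂ : Fin n) →
       V G u₁ ≡ true → V G v₁ ≡ true → V G v₂ ≡ true → V G u₂ ≡ true →
       u₁ ≢ v₁ → u₁ ≢ v₂ → u₁ ≢ u₂ → v₁ ≢ v₂ → v₁ ≢ u₂ → v₂ ≢ u₂ →
       Adj G u₁ v₁ → Adj G v₁ v₂ → Adj G v₂ u₂ →
       ¬ Adj G u₁ v₂ → ¬ Adj G u₁ u₂ → ¬ Adj G v₁ u₂ →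
       deg G v₁ ≡ 2 → deg G v₂ ≡ 2 →
       h v₁ ≡ 0 → h v₂ ≡ 0 →
       AT G h → ¬ AT (deleteVertex (deleteVertex G v₁) v₂) h →
       AT (addEdge (deleteVertex (deleteVertex G v₁) v₂) u₁ u₂) h)
corollary2 =
  (λ n G h _ i → Stretching.stretch-non-AT G h i) ,
  (λ n G h _ u₁ v₁ v₂ u₂ _ Vv₁ Vv₂ _ u₁≢v₁ u₁≢v₂ u₁≢u₂ v₁≢v₂ v₁≢u₂ v₂≢u₂ adj₁ adj₂ adj₃ _ _ _ →
     Suppression.suppress G h
       (record { p≢x = u₁≢v₁ ; p≢y = u₁≢v₂ ; q≢x = ≢-sym v₁≢u₂ ; q≢y = ≢-sym v₂≢u₂ ; x≢y = v₁≢v₂ })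
       u₁≢u₂ adj₁ adj₂ adj₃ Vv₁ Vv₂)
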